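{- Let $\alpha\in\{0,1,2,3\}^*$ and let $w=1\alpha3\alpha2$. Then either $w$ contains a square as a subword, or $w$ contains an occurrence of one of the subwords $12$, $13$, $21$, $32$, $231$, $10302$.
   Context: A subword is a contiguous block; a square is a nonempty word of the form $xx$. -}

module Defs where

open import Data.Fin using (Fin)
open import Data.List using (List; []; _∷_; _++_)
open import Data.Product using (∃; ∃-syntax; _×_)
open import Relation.Binary.PropositionalEquality using (_≡_)
open import Relation.Nullary using (¬_)

Letter : Set
Letter = Fin 4

Word : Set
Word = List Letter

Subword : Word → Word → Set
Subword x w = ∃[ u ] ∃[ v ] (w ≡ u ++ x ++ v)

ContainsSquare : Word → Set
ContainsSquare w = ∃[ x ] (¬ (x ≡ []) × Subword (x ++ x) w)

open import Data.Fin using (zero; suc)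

l0 l1 l2 l3 : Letter
l0 = zero
l1 = suc zero
l2 = suc (suc zero)
l3 = suc (suc (suc zero))

-- Suppose α has at least three letters, A its first three and B its last three
-- (they may overlap). Then w = 1α3α2 contains the factors 1A, B2 and B3A, and
-- an exhaustive check of the 4⁶ choices of A and B shows that one of these
-- three short words already contains a square or one of the listed factors.
-- The words α with at most two letters are checked directly.
module Submission where

open import Defs
open import Data.Fin.Properties using (all?) renaming (_≟_ to _≟ᶠ_)
open import Data.List using (List; []; _∷_; _++_; [_]; head; mapMaybe; concatMap; inits; tails)
open import Data.List.Properties using (++-monoid; ++-assoc)
open import Algebra.Solver.Monoid (++-monoid Letter) using (solve; _⊜_; _⊕_; id)
import Data.List.Relation.Binary.Infix.Heterogeneous as Infix
open Infix using (Infix; MkView)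
import Data.List.Relation.Binary.Infix.Heterogeneous.Properties as Infixₚ
open import Data.List.Relation.Binary.Pointwise using (Pointwise-≡⇒≡; ≡⇒Pointwise-≡)
open import Data.Maybe using (Maybe; nothing; is-just; _<∣>_; to-witness-T) renaming (map to mapᵐ)
open import Data.Product using (∃-syntax; _,_)
open import Data.Sum using (_⊎_; inj₁; inj₂; [_,_]′) renaming (map to map⊎)
open import Relation.Binary.Definitions using (Decidable)
open import Relation.Binary.PropositionalEquality using (_≡_; refl; cong; sym; trans; cong₂; module ≡-Reasoning)
open import Relation.Nullary using (map′; dec⇒maybe; T?)
open import Relation.Nullary.Decidable using (from-yes)

unsnoc₃ : ∀ {a} {X : Set a} (x y z : X) (r : List X) →
  ∃[ p ] ∃[ b₁ ] ∃[ b₂ ] ∃[ b₃ ] x ∷ y ∷ z ∷ r ≡ p ++ b₁ ∷ b₂ ∷ b₃ ∷ []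
unsnoc₃ x y z []      = [] , x , y , z , refl
unsnoc₃ x y z (t ∷ r) with p , b₁ , b₂ , b₃ , eq ← unsnoc₃ y z t r = x ∷ p , b₁ , b₂ , b₃ , cong (x ∷_) eq

Infix⇒Subword : ∀ {x w} → Infix _≡_ x w → Subword x w
Infix⇒Subword p with MkView u x≋y v ← Infix.toView p =
  u , v , cong (λ y → u ++ y ++ v) (sym (Pointwise-≡⇒≡ x≋y))

Subword⇒Infix : ∀ {x w} → Subword x w → Infix _≡_ x w
Subword⇒Infix (u , v , refl) = Infix.fromView (MkView u (≡⇒Pointwise-≡ refl) v)

subword? : Decidable Subword
subword? x w = map′ Infix⇒Subword Subword⇒Infix (Infixₚ.infix? _≟ᶠ_ x w)

Subword-trans : ∀ {x y w} → Subword x y → Subword y w → Subword x w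
Subword-trans x⊑y y⊑w =
  Infix⇒Subword (Infixₚ.trans trans (Subword⇒Infix x⊑y) (Subword⇒Infix y⊑w))

ContainsSquare-mono : ∀ {x w} → Subword x w → ContainsSquare x → ContainsSquare w
ContainsSquare-mono x⊑w (y , y≢[] , yy⊑x) = y , y≢[] , Subword-trans yy⊑x x⊑w

Forbidden : Word → Set
Forbidden w = ContainsSquare w
    ⊎ (Subword (l1 ∷ l2 ∷ []) w
    ⊎ (Subword (l1 ∷ l3 ∷ []) w
    ⊎ (Subword (l2 ∷ l1 ∷ []) w
    ⊎ (Subword (l3 ∷ l2 ∷ []) w
    ⊎ (Subword (l2 ∷ l3 ∷ l1 ∷ []) w
    ⊎ Subword (l1 ∷ l0 ∷ l3 ∷ l0 ∷ l2 ∷ []) w)))))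

Forbidden-mono : ∀ {x w} → Subword x w → Forbidden x → Forbidden w
Forbidden-mono {x} {w} x⊑w =
  map⊎ (ContainsSquare-mono x⊑w) (map⊎ lift (map⊎ lift (map⊎ lift (map⊎ lift (map⊎ lift lift)))))
  where
  lift : ∀ {f} → Subword f x → Subword f w
  lift f⊑x = Subword-trans f⊑x x⊑w

findSquare : (w : Word) → Maybe (ContainsSquare w)
findSquare w = head (mapMaybe squareOf (concatMap inits (tails w)))
  where
  squareOf : Word → Maybe (ContainsSquare w)
  squareOf []         = nothing
  squareOf x@(_ ∷ _) = mapᵐ (λ xx⊑w → x , (λ ()) , xx⊑w) (dec⇒maybe (subword? (x ++ x) w))

findForbidden : (w : Word) → Maybe (Forbidden w)
findForbidden w = mapᵐ inj₁ (findSquare w)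
  <∣> mapᵐ (λ p → inj₂ (inj₁ p)) (find _)
  <∣> mapᵐ (λ p → inj₂ (inj₂ (inj₁ p))) (find _)
  <∣> mapᵐ (λ p → inj₂ (inj₂ (inj₂ (inj₁ p)))) (find _)
  <∣> mapᵐ (λ p → inj₂ (inj₂ (inj₂ (inj₂ (inj₁ p))))) (find _)
  <∣> mapᵐ (λ p → inj₂ (inj₂ (inj₂ (inj₂ (inj₂ (inj₁ p)))))) (find _)
  <∣> mapᵐ (λ p → inj₂ (inj₂ (inj₂ (inj₂ (inj₂ (inj₂ p)))))) (find _)
  where
  find : (x : Word) → Maybe (Subword x w)
  find x = dec⇒maybe (subword? x w)

frame : Word → Word
frame α = l1 ∷ α ++ l3 ∷ α ++ l2 ∷ []

Windows : Word → Word → Set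
Windows A B = Forbidden (l1 ∷ A) ⊎ Forbidden (B ++ l2 ∷ []) ⊎ Forbidden (B ++ l3 ∷ A)

frame-prefix : ∀ {α} A α₁ → α ≡ A ++ α₁ → Subword (l1 ∷ A) (frame α)
frame-prefix A α₁ refl = [] , α₁ ++ l3 ∷ (A ++ α₁) ++ l2 ∷ [] , cong (l1 ∷_) (++-assoc A α₁ _)

frame-suffix : ∀ {α} α₂ B → α ≡ α₂ ++ B → Subword (B ++ l2 ∷ []) (frame α)
frame-suffix α₂ B refl = l1 ∷ (α₂ ++ B) ++ l3 ∷ α₂ , [] ,
  solve 5 (λ c₁ x b c₃ c₂ → c₁ ⊕ ((x ⊕ b) ⊕ (c₃ ⊕ ((x ⊕ b) ⊕ c₂)))
                         ⊜ (c₁ ⊕ ((x ⊕ b) ⊕ (c₃ ⊕ x))) ⊕ ((b ⊕ c₂) ⊕ id)) refl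
    [ l1 ] α₂ B [ l3 ] [ l2 ]

frame-middle : ∀ {α} A α₁ α₂ B → α ≡ A ++ α₁ → α ≡ α₂ ++ B → Subword (B ++ l3 ∷ A) (frame α)
frame-middle {α} A α₁ α₂ B α≡Aα₁ α≡α₂B = l1 ∷ α₂ , α₁ ++ l2 ∷ [] , (begin
    l1 ∷ α ++ l3 ∷ α ++ l2 ∷ []
  ≡⟨ cong₂ (λ β γ → l1 ∷ β ++ l3 ∷ γ ++ l2 ∷ []) α≡α₂B α≡Aα₁ ⟩
    l1 ∷ (α₂ ++ B) ++ l3 ∷ (A ++ α₁) ++ l2 ∷ []
  ≡⟨ solve 7 (λ c₁ x b c₃ a y c₂ → c₁ ⊕ ((x ⊕ b) ⊕ (c₃ ⊕ ((a ⊕ y) ⊕ c₂)))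
                                ⊜ (c₁ ⊕ x) ⊕ ((b ⊕ (c₃ ⊕ a)) ⊕ (y ⊕ c₂))) refl
       [ l1 ] α₂ B [ l3 ] A α₁ [ l2 ] ⟩
    (l1 ∷ α₂) ++ (B ++ l3 ∷ A) ++ α₁ ++ l2 ∷ []
  ∎)
  where open ≡-Reasoning

Forbidden-frame : ∀ {α} A α₁ α₂ B → α ≡ A ++ α₁ → α ≡ α₂ ++ B → Windows A B → Forbidden (frame α)
Forbidden-frame A α₁ α₂ B α≡Aα₁ α≡α₂B =
  [ Forbidden-mono (frame-prefix A α₁ α≡Aα₁)
  , [ Forbidden-mono (frame-suffix α₂ B α≡α₂B)
    , Forbidden-mono (frame-middle A α₁ α₂ B α≡Aα₁ α≡α₂B) ]′ ]′

Forbidden-frame[] : Forbidden (frame [])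
Forbidden-frame[] = to-witness-T (findForbidden (frame [])) _

Forbidden-frame[a] : ∀ a → Forbidden (frame [ a ])
Forbidden-frame[a] a = to-witness-T (findForbidden (frame [ a ]))
  (from-yes (all? λ a → T? (is-just (findForbidden (frame [ a ])))) a)

Forbidden-frame[ab] : ∀ a b → Forbidden (frame (a ∷ b ∷ []))
Forbidden-frame[ab] a b = to-witness-T (findForbidden (frame (a ∷ b ∷ [])))
  (from-yes (all? λ a → all? λ b → T? (is-just (findForbidden (frame (a ∷ b ∷ []))))) a b)

findWindows : ∀ A B → Maybe (Windows A B)
findWindows A B = mapᵐ inj₁ (findForbidden _)
  <∣> mapᵐ (λ p → inj₂ (inj₁ p)) (findForbidden _)
  <∣> mapᵐ (λ p → inj₂ (inj₂ p)) (findForbidden _)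

windows₃ : ∀ a₁ a₂ a₃ b₁ b₂ b₃ → Windows (a₁ ∷ a₂ ∷ a₃ ∷ []) (b₁ ∷ b₂ ∷ b₃ ∷ [])
windows₃ a₁ a₂ a₃ b₁ b₂ b₃ = to-witness-T (findWindows (a₁ ∷ a₂ ∷ a₃ ∷ []) (b₁ ∷ b₂ ∷ b₃ ∷ []))
  (from-yes (all? λ a₁ → all? λ a₂ → all? λ a₃ → all? λ b₁ → all? λ b₂ → all? λ b₃ →
    T? (is-just (findWindows (a₁ ∷ a₂ ∷ a₃ ∷ []) (b₁ ∷ b₂ ∷ b₃ ∷ []))))
    a₁ a₂ a₃ b₁ b₂ b₃)

lemma5 : (α : Word) →
    let w = l1 ∷ α ++ l3 ∷ α ++ l2 ∷ [] in
    ContainsSquare w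
      ⊎ (Subword (l1 ∷ l2 ∷ []) w
      ⊎ (Subword (l1 ∷ l3 ∷ []) w
      ⊎ (Subword (l2 ∷ l1 ∷ []) w
      ⊎ (Subword (l3 ∷ l2 ∷ []) w
      ⊎ (Subword (l2 ∷ l3 ∷ l1 ∷ []) w
      ⊎ Subword (l1 ∷ l0 ∷ l3 ∷ l0 ∷ l2 ∷ []) w)))))
lemma5 []          = Forbidden-frame[]
lemma5 (a ∷ [])     = Forbidden-frame[a] a
lemma5 (a ∷ b ∷ []) = Forbidden-frame[ab] a b
lemma5 (a₁ ∷ a₂ ∷ a₃ ∷ α₁)
  with α₂ , b₁ , b₂ , b₃ , α≡α₂B ← unsnoc₃ a₁ a₂ a₃ α₁ =
  Forbidden-frame A α₁ α₂ B refl α≡α₂B (windows₃ a₁ a₂ a₃ b₁ b₂ b₃)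
  where
  A B : Word
  A = a₁ ∷ a₂ ∷ a₃ ∷ []
  B = b₁ ∷ b₂ ∷ b₃ ∷ []
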